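{- For any tree $T$ in $\mathcal{R}_{UVR}$ (with maximum degree at least $2$), $b_R(T)=1$.
   Context: A Roman dominating function (RDF) on a graph $G$ is a map $f:V(G)\to\{0,1,2\}$ such that every vertex with $f$-value $0$ has a neighbor with $f$-value $2$; its weight is $\sum_v f(v)$ and $\gamma_R(G)$ is the minimum weight of an RDF. $\mathcal{R}_{UVR}$ is the class of graphs $G$ with $\gamma_R(G-v)=\gamma_R(G)$ for all $v\in V(G)$. For $G$ with maximum degree at least $2$, the Roman bondage number $b_R(G)$ is the minimum cardinality of a set $E_1\subseteq E(G)$ with $\gamma_R(G-E_1)>\gamma_R(G)$. -}

module Defs where

open import Data.Bool using (Bool; true; false; _∧_; not; if_then_else_)
open import Data.Nat using (ℕ; zero; suc; _+_; _≤_; _<_; _<ᵇ_)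
open import Data.Fin using (Fin; toℕ; punchIn)
open import Data.List using (List; []; _∷_; _++_; [_]; length; tabulate)
open import Data.Nat.ListAction using (sum)
open import Data.List.Relation.Unary.Unique.Propositional using (Unique)
open import Data.Product using (Σ; _×_; ∃; ∃-syntax)
open import Data.Unit using (⊤)
open import Data.Empty using (⊥)
open import Relation.Binary.PropositionalEquality using (_≡_; _≢_)
open import Relation.Nullary using (¬_)

record Graph (n : ℕ) : Set where
  field
    adj    : Fin n → Fin n → Bool
    sym    : ∀ u v → adj u v ≡ adj v u
    irrefl : ∀ v → adj v v ≡ false
open Graph public

Adj : ∀ {n} → Graph n → Fin n → Fin n → Set
Adj G u v = adj G u v ≡ true

degree : ∀ {n} → Graph n → Fin n → ℕ
degree {n} G v = sum (tabulate {n = n} (λ u → if adj G v u then 1 else 0))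

MaxDegreeAtLeast2 : ∀ {n} → Graph n → Set
MaxDegreeAtLeast2 G = ∃[ v ] 2 ≤ degree G v

data Walk {n} (G : Graph n) : Fin n → Fin n → Set where
  here : ∀ {v} → Walk G v v
  step : ∀ {u w v} → Adj G u w → Walk G w v → Walk G u v

Connected : ∀ {n} → Graph n → Set
Connected G = ∀ u v → Walk G u v

Chain : ∀ {n} → Graph n → List (Fin n) → Set
Chain G []           = ⊤
Chain G (x ∷ [])     = ⊤
Chain G (x ∷ y ∷ xs) = Adj G x y × Chain G (y ∷ xs)

-- a cycle x, mid..., y, (back to x) with at least 3 distinct vertices
HasCycle : ∀ {n} → Graph n → Set
HasCycle {n} G =
  Σ (Fin n) λ x → Σ (Fin n) λ y → Σ (List (Fin n)) λ mid →
    (1 ≤ length mid) × Unique (x ∷ mid ++ [ y ]) × Chain G (x ∷ mid ++ [ y ]) × Adj G y x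

IsTree : ∀ {m} → Graph (suc m) → Set
IsTree G = Connected G × ¬ HasCycle G

IsRDF : ∀ {n} → Graph n → (Fin n → ℕ) → Set
IsRDF {n} G f = (∀ v → f v ≤ 2) × (∀ v → f v ≡ 0 → ∃[ u ] (Adj G v u × f u ≡ 2))

weight : ∀ {n} → (Fin n → ℕ) → ℕ
weight {n} f = sum (tabulate {n = n} f)

γR : ∀ {n} → Graph n → ℕ → Set
γR G k = (Σ _ λ f → IsRDF G f × weight f ≡ k) × (∀ f → IsRDF G f → k ≤ weight f)

_─v_ : ∀ {m} → Graph (suc m) → Fin (suc m) → Graph m
adj    (G ─v v) i j = adj G (punchIn v i) (punchIn v j)
sym    (G ─v v) i j = sym G (punchIn v i) (punchIn v j)
irrefl (G ─v v) i   = irrefl G (punchIn v i)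

InRUVR : ∀ {m} → Graph (suc m) → Set
InRUVR G = ∀ v k k′ → γR G k → γR (G ─v v) k′ → k ≡ k′

record EdgeSubset {n} (G : Graph n) : Set where
  field
    mem    : Fin n → Fin n → Bool
    memSym : ∀ u v → mem u v ≡ mem v u
    memSub : ∀ u v → mem u v ≡ true → Adj G u v
open EdgeSubset public

-- |E1| : number of unordered pairs {u,v} (counted once, with u < v) in E1.
card : ∀ {n} {G : Graph n} → EdgeSubset G → ℕ
card {n} E = sum (tabulate {n = n} λ u → sum (tabulate {n = n} λ v →
               if (toℕ u <ᵇ toℕ v) ∧ mem E u v then 1 else 0))

_─E_ : ∀ {n} (G : Graph n) → EdgeSubset G → Graph n
adj    (G ─E E) u v = adj G u v ∧ not (mem E u v)
sym    (G ─E E) u v rewrite sym G u v | memSym E u v = Relation.Binary.PropositionalEquality.refl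
irrefl (G ─E E) v rewrite irrefl G v = Relation.Binary.PropositionalEquality.refl

IncreasesγR : ∀ {n} (G : Graph n) → EdgeSubset G → Set
IncreasesγR G E = ∀ k k′ → γR G k → γR (G ─E E) k′ → k < k′

RomanBondage : ∀ {n} → Graph n → ℕ → Set
RomanBondage G b =
  (Σ (EdgeSubset G) λ E → card E ≡ b × IncreasesγR G E)
  × (∀ E → IncreasesγR G E → b ≤ card E)

-- Of the tree hypothesis only acyclicity matters: a graph with an edge and no
-- cycle has a leaf v, the end of a maximal path. Deleting the edge uv to its
-- neighbour isolates v, so every RDF f of T - uv has f(v) ≥ 1 and restricts to an
-- RDF of T - v; hence γ_R(T - uv) ≥ γ_R(T - v) + 1 = γ_R(T) + 1 as T ∈ R_UVR.
-- An edge set of cardinality 0 is empty and changes nothing, so b_R(T) = 1.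
module Submission where

open import Defs hiding (sym)
open import Data.Bool using (true; false; _∧_; if_then_else_)
open import Data.Bool.Properties using (∧-conicalˡ; ∧-zeroʳ; ¬-not)
import Data.Bool.Properties as Bool
open import Data.Fin using (Fin; zero; suc; toℕ; punchIn; punchOut)
open import Data.Fin.Properties using (any?; all?; punchIn-punchOut; punchInᵢ≢i; toℕ-injective)
import Data.Fin.Properties as Fin
open import Data.List using (List; []; _∷_; _++_; [_]; length; tabulate; upTo; filter; cartesianProductWith)
open import Data.List.Extrema.Nat using (argmin; argmin-all; f[argmin]≤v⁺)
open import Data.List.Membership.Propositional using (_∈_)
open import Data.List.Membership.Propositional.Properties using (∈-upTo⁺; ∈-allFin; ∈-∃++; ∈-++⁻; ∈-++⁺ˡ; ∈-++⁺ʳ)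
import Data.List.Membership.DecPropositional as DecMembership
open import Data.List.Properties using (tabulate-cong; length-++-sucʳ; length-tabulate; ++-assoc)
open import Data.List.Relation.Binary.Subset.Propositional using (_⊆_)
open import Data.List.Relation.Unary.All using ([]; _∷_)
import Data.List.Relation.Unary.All as All
open import Data.List.Relation.Unary.All.Properties using (all-filter; ¬Any⇒All¬)
import Data.List.Relation.Unary.All.Properties as Allₚ
open import Data.List.Relation.Unary.AllPairs using (AllPairs; []; _∷_)
open import Data.List.Relation.Unary.Any using (Any; here; there)
import Data.List.Relation.Unary.Any as Any
open import Data.List.Relation.Unary.Any.Properties using (cartesianProductWith⁺; lookup-result)
import Data.List.Relation.Unary.Any.Properties as Any
open import Data.List.Relation.Unary.Unique.Propositional using (Unique)
open import Data.Nat using (ℕ; zero; suc; _+_; _≤_; _<_; _<ᵇ_; z≤n; s≤s; _≤?_)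
open import Data.Nat.ListAction using (sum)
open import Data.Nat.Properties using (<ᵇ-reflects-<; ≤-trans; ≤-reflexive; m+n≡0⇒m≡0; +-0-commutativeMonoid)
import Data.Nat.Properties as ℕ
open import Algebra.Properties.CommutativeMonoid.Sum +-0-commutativeMonoid using (sum-remove) renaming (sum to ∑)
open import Data.Product using (Σ; _×_; ∃; ∃₂; ∃-syntax; _,_; proj₁; proj₂)
open import Data.Sum using (_⊎_; inj₁; inj₂)
import Data.Vec.Functional as Vector
open import Function using (_∘_; const; mk⇔)
open import Relation.Binary using (tri<; tri≈; tri>)
open import Relation.Binary.PropositionalEquality using (_≡_; _≢_; refl; sym; trans; cong; cong₂; subst; _≗_; module ≡-Reasoning)
open import Relation.Nullary using (¬_; Dec; yes; no; does; _because_; contradiction)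
open import Relation.Nullary.Decidable using (dec-true; dec-false; does-⇔; _×-dec_; _→-dec_; _⊎-dec_)
open import Relation.Unary using (Decidable)

sum-tabulate≡∑ : ∀ {n} (h : Fin n → ℕ) → sum (tabulate h) ≡ ∑ h
sum-tabulate≡∑ {zero}  h = refl
sum-tabulate≡∑ {suc n} h = cong (h zero +_) (sum-tabulate≡∑ (h ∘ suc))

sum-tabulate-punchIn : ∀ {n} (h : Fin (suc n) → ℕ) i →
                       sum (tabulate h) ≡ h i + sum (tabulate (h ∘ punchIn i))
sum-tabulate-punchIn h i = begin
  sum (tabulate h)                     ≡⟨ sum-tabulate≡∑ h ⟩
  ∑ h                                  ≡⟨ sum-remove {i = i} h ⟩
  h i + ∑ (h ∘ punchIn i)              ≡⟨ cong (h i +_) (sum-tabulate≡∑ (h ∘ punchIn i)) ⟨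
  h i + sum (tabulate (h ∘ punchIn i)) ∎
  where open ≡-Reasoning

sum-tabulate-zero : ∀ {n} (h : Fin n → ℕ) → (∀ i → h i ≡ 0) → sum (tabulate h) ≡ 0
sum-tabulate-zero {zero}  h h≡0 = refl
sum-tabulate-zero {suc n} h h≡0 rewrite h≡0 zero = sum-tabulate-zero (h ∘ suc) (h≡0 ∘ suc)

sum-tabulate≡0⇒≡0 : ∀ {n} (h : Fin n → ℕ) → sum (tabulate h) ≡ 0 → ∀ i → h i ≡ 0
sum-tabulate≡0⇒≡0 {suc n} h Σ≡0 i = m+n≡0⇒m≡0 (h i) (trans (sym (sum-tabulate-punchIn h i)) Σ≡0)

sum-tabulate-single : ∀ {n} (h : Fin n → ℕ) i → (∀ j → j ≢ i → h j ≡ 0) → sum (tabulate h) ≡ h i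
sum-tabulate-single {suc n} h i h≡0 = begin
  sum (tabulate h)                     ≡⟨ sum-tabulate-punchIn h i ⟩
  h i + sum (tabulate (h ∘ punchIn i)) ≡⟨ cong (h i +_) (sum-tabulate-zero _ (λ j → h≡0 _ (punchInᵢ≢i i j))) ⟩
  h i + 0                              ≡⟨ ℕ.+-identityʳ (h i) ⟩
  h i                                  ∎
  where open ≡-Reasoning

module _ {A : Set} (w : A → ℕ) {P : A → Set} (P? : Decidable P) where

  minimiser : (xs : List A) {a : A} → P a → (∀ x → P x → Any (λ y → P y × w y ≤ w x) xs) →
              Σ A λ m → P m × (∀ x → P x → w m ≤ w x)
  minimiser xs {a} pa dominated = m , argmin-all w pa (all-filter P? xs) , minimal
    where
    m : A
    m = argmin w a (filter P? xs)
    minimal : ∀ x → P x → w m ≤ w x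
    minimal x px with Any.filter⁺ P? (dominated x px)
    ... | inj₁ found = f[argmin]≤v⁺ a (filter P? xs) (inj₂ (Any.map proj₂ found))
    ... | inj₂ ¬py   = contradiction (proj₁ (lookup-result (dominated x px))) ¬py

boundedFunctions : (n b : ℕ) → List (Fin n → ℕ)
boundedFunctions zero    b = [ (λ ()) ]
boundedFunctions (suc n) b = cartesianProductWith Vector._∷_ (upTo (suc b)) (boundedFunctions n b)

boundedFunctions-complete : ∀ n b (f : Fin n → ℕ) → (∀ i → f i ≤ b) → Any (f ≗_) (boundedFunctions n b)
boundedFunctions-complete zero    b f f≤b = here (λ ())
boundedFunctions-complete (suc n) b f f≤b =
  cartesianProductWith⁺ Vector._∷_ cons (∈-upTo⁺ (s≤s (f≤b zero)))
    (boundedFunctions-complete n b (f ∘ suc) (f≤b ∘ suc))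
  where
  cons : ∀ {c g} → f zero ≡ c → f ∘ suc ≗ g → f ≗ c Vector.∷ g
  cons f0≡c _    zero    = f0≡c
  cons _    fs≗g (suc i) = fs≗g i

module _ {n : ℕ} where

  Adj-sym : (G : Graph n) {x y : Fin n} → Adj G x y → Adj G y x
  Adj-sym G {x} {y} xy = trans (Graph.sym G y x) xy

  Adj-irrefl : (G : Graph n) {x : Fin n} → ¬ Adj G x x
  Adj-irrefl G {x} xx with () ← trans (sym xx) (irrefl G x)

  Adj⇒≢ : (G : Graph n) {x y : Fin n} → Adj G x y → x ≢ y
  Adj⇒≢ G xy refl = Adj-irrefl G xy

  _⊆ᴱ_ : Graph n → Graph n → Set
  H ⊆ᴱ G = ∀ x y → Adj H x y → Adj G x y

  IsRDF-≗ : (G : Graph n) {f g : Fin n → ℕ} → f ≗ g → IsRDF G f → IsRDF G g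
  IsRDF-≗ G f≗g (f≤2 , dominated) =
    (λ v → subst (_≤ 2) (f≗g v) (f≤2 v)) ,
    (λ v gv≡0 → let u , vu , fu≡2 = dominated v (trans (f≗g v) gv≡0)
                in u , vu , trans (sym (f≗g u)) fu≡2)

  IsRDF-⊆ᴱ : {H G : Graph n} {f : Fin n → ℕ} → H ⊆ᴱ G → IsRDF H f → IsRDF G f
  IsRDF-⊆ᴱ H⊆G (f≤2 , dominated) =
    f≤2 , λ v fv≡0 → let u , vu , fu≡2 = dominated v fv≡0 in u , H⊆G v u vu , fu≡2

  isRDF? : (G : Graph n) → Decidable (IsRDF G)
  isRDF? G f = all? (λ v → f v ≤? 2) ×-dec
               all? (λ v → (f v ℕ.≟ 0) →-dec any? (λ u → (adj G v u Bool.≟ true) ×-dec (f u ℕ.≟ 2)))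

  weight-≗ : {f g : Fin n → ℕ} → f ≗ g → weight f ≡ weight g
  weight-≗ f≗g = cong sum (tabulate-cong f≗g)

  const1-isRDF : (G : Graph n) → IsRDF G (const 1)
  const1-isRDF G = (λ _ → s≤s z≤n) , λ _ ()

  IsRDF-listed : (G : Graph n) (f : Fin n → ℕ) → IsRDF G f →
                 Any (λ g → IsRDF G g × weight g ≤ weight f) (boundedFunctions n 2)
  IsRDF-listed G f rdf = Any.map (λ f≗g → IsRDF-≗ G f≗g rdf , ≤-reflexive (sym (weight-≗ f≗g)))
                                 (boundedFunctions-complete n 2 f (proj₁ rdf))

  γR-exists : (G : Graph n) → ∃ (γR G)
  γR-exists G
    with m , rdf , minimal ←
           minimiser (weight {n}) (isRDF? G) (boundedFunctions n 2) (const1-isRDF G) (IsRDF-listed G)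
    = weight m , (m , rdf , refl) , minimal

  γR-antitone : {H G : Graph n} {k k′ : ℕ} → H ⊆ᴱ G → γR G k → γR H k′ → k ≤ k′
  γR-antitone {H} {G} H⊆G (_ , minimal) ((f , rdf , wf≡k′) , _) =
    ≤-trans (minimal f (IsRDF-⊆ᴱ {H = H} {G = G} H⊆G rdf)) (≤-reflexive wf≡k′)

  ─E-⊆ᴱ : (G : Graph n) (E : EdgeSubset G) → (G ─E E) ⊆ᴱ G
  ─E-⊆ᴱ G E x y = ∧-conicalˡ (adj G x y) _

  ⊆ᴱ-─E : (G : Graph n) (E : EdgeSubset G) → (∀ x y → mem E x y ≡ false) → G ⊆ᴱ (G ─E E)
  ⊆ᴱ-─E G E E≡∅ x y xy rewrite E≡∅ x y | xy = refl

  ─E-removes : (G : Graph n) (E : EdgeSubset G) {x y : Fin n} → mem E x y ≡ true → ¬ Adj (G ─E E) x y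
  ─E-removes G E {x} {y} xy∈E rewrite xy∈E | ∧-zeroʳ (adj G x y) = λ ()

  Isolated : Graph n → Fin n → Set
  Isolated G v = ∀ w → ¬ Adj G v w

  Leaf : Graph n → Fin n → Fin n → Set
  Leaf G v u = Adj G v u × (∀ w → Adj G v w → w ≡ u)

  Leaf-─E-isolated : (G : Graph n) (E : EdgeSubset G) {v u : Fin n} →
                     Leaf G v u → mem E v u ≡ true → Isolated (G ─E E) v
  Leaf-─E-isolated G E {v} (_ , unique) vu∈E w vw with refl ← unique w (─E-⊆ᴱ G E v w vw) =
    ─E-removes G E vu∈E vw

  isolated⇒RDF-positive : (G : Graph n) {v : Fin n} {f : Fin n → ℕ} → Isolated G v → IsRDF G f → 0 < f v
  isolated⇒RDF-positive G {v} {f} isolated (_ , dominated) with f v in fv≡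
  ... | suc _ = s≤s z≤n
  ... | zero  = let w , vw , _ = dominated v fv≡ in contradiction vw (isolated w)

  -- Unlike ℕ._<?_, this decision has `a <ᵇ b` (the test used by `card`) as its `does`.
  _<ᵇ-dec_ : (a b : ℕ) → Dec (a < b)
  a <ᵇ-dec b = (a <ᵇ b) because <ᵇ-reflects-< a b

  edgeIndicator : {G : Graph n} → EdgeSubset G → Fin n → Fin n → ℕ
  edgeIndicator E x y = if (toℕ x <ᵇ toℕ y) ∧ mem E x y then 1 else 0

  mem-diagonal : (G : Graph n) (E : EdgeSubset G) (x : Fin n) → mem E x x ≡ false
  mem-diagonal G E x with mem E x x in xx∈E
  ... | false = refl
  ... | true  = contradiction (memSub E x x xx∈E) (Adj-irrefl G)

  edgeIndicator≡0⇒∉ : {G : Graph n} (E : EdgeSubset G) {x y : Fin n} →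
                      edgeIndicator E x y ≡ 0 → toℕ x < toℕ y → mem E x y ≡ false
  edgeIndicator≡0⇒∉ E {x} {y} ind≡0 x<y with mem E x y
  ... | false = refl
  ... | true rewrite dec-true (toℕ x <ᵇ-dec toℕ y) x<y = contradiction ind≡0 λ ()

  card≡0⇒edgeIndicator≡0 : {G : Graph n} (E : EdgeSubset G) → card E ≡ 0 → ∀ x y → edgeIndicator E x y ≡ 0
  card≡0⇒edgeIndicator≡0 E |E|≡0 x = sum-tabulate≡0⇒≡0 _ (sum-tabulate≡0⇒≡0 _ |E|≡0 x)

  card≡0⇒empty : (G : Graph n) (E : EdgeSubset G) → card E ≡ 0 → ∀ x y → mem E x y ≡ false
  card≡0⇒empty G E |E|≡0 x y with ℕ.<-cmp (toℕ x) (toℕ y)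
  ... | tri< x<y _ _ = edgeIndicator≡0⇒∉ E (card≡0⇒edgeIndicator≡0 E |E|≡0 x y) x<y
  ... | tri> _ _ y<x =
    trans (memSym E x y) (edgeIndicator≡0⇒∉ E (card≡0⇒edgeIndicator≡0 E |E|≡0 y x) y<x)
  ... | tri≈ _ x≡y _ rewrite toℕ-injective x≡y = mem-diagonal G E y

  increasesγR⇒nonempty : (G : Graph n) (E : EdgeSubset G) → IncreasesγR G E → 1 ≤ card E
  increasesγR⇒nonempty G E increases with card E in |E|≡0
  ... | suc _ = s≤s z≤n
  ... | zero with k , γG ← γR-exists G | k′ , γG-E ← γR-exists (G ─E E) =
    contradiction (increases k k′ γG γG-E)
      (ℕ.≤⇒≯ (γR-antitone {H = G} {G = G ─E E} (⊆ᴱ-─E G E (card≡0⇒empty G E |E|≡0)) γG-E γG))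

  SameEdge : Fin n → Fin n → Fin n → Fin n → Set
  SameEdge p q x y = (x ≡ p × y ≡ q) ⊎ (x ≡ q × y ≡ p)

  sameEdge? : ∀ p q x y → Dec (SameEdge p q x y)
  sameEdge? p q x y = (x Fin.≟ p ×-dec y Fin.≟ q) ⊎-dec (x Fin.≟ q ×-dec y Fin.≟ p)

  SameEdge-sym : ∀ {p q x y} → SameEdge p q x y → SameEdge p q y x
  SameEdge-sym (inj₁ (x≡p , y≡q)) = inj₂ (y≡q , x≡p)
  SameEdge-sym (inj₂ (x≡q , y≡p)) = inj₁ (y≡p , x≡q)

  singleEdge : (G : Graph n) {p q : Fin n} → Adj G p q → EdgeSubset G
  mem    (singleEdge G {p} {q} _) x y = does (sameEdge? p q x y)
  memSym (singleEdge G {p} {q} _) x y =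
    does-⇔ (mk⇔ SameEdge-sym SameEdge-sym) (sameEdge? p q x y) (sameEdge? p q y x)
  memSub (singleEdge G {p} {q} pq) x y xy∈E with sameEdge? p q x y
  ... | yes (inj₁ (refl , refl)) = pq
  ... | yes (inj₂ (refl , refl)) = Adj-sym G pq
  ... | no xy≭pq = contradiction (trans (sym (dec-false (sameEdge? p q x y) xy≭pq)) xy∈E) λ ()

  singleEdge-mem : (G : Graph n) {p q : Fin n} (pq : Adj G p q) → mem (singleEdge G pq) p q ≡ true
  singleEdge-mem G {p} {q} pq = dec-true (sameEdge? p q p q) (inj₁ (refl , refl))

  singleEdge-indicator : (G : Graph n) {p q : Fin n} (pq : Adj G p q) → toℕ p < toℕ q →
                         ∀ x y → ¬ (x ≡ p × y ≡ q) → edgeIndicator (singleEdge G pq) x y ≡ 0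
  singleEdge-indicator G {p} {q} pq p<q x y xy≢pq with sameEdge? p q x y
  ... | no xy≭pq =
    trans (cong (λ b → if (toℕ x <ᵇ toℕ y) ∧ b then 1 else 0) (dec-false (sameEdge? p q x y) xy≭pq))
          (cong (if_then 1 else 0) (∧-zeroʳ (toℕ x <ᵇ toℕ y)))
  ... | yes (inj₁ xy≡pq) = contradiction xy≡pq xy≢pq
  ... | yes (inj₂ (refl , refl)) rewrite dec-false (toℕ q <ᵇ-dec toℕ p) (ℕ.<⇒≯ p<q) = refl

  singleEdge-card : (G : Graph n) {p q : Fin n} (pq : Adj G p q) → toℕ p < toℕ q → card (singleEdge G pq) ≡ 1
  singleEdge-card G {p} {q} pq p<q = begin
    card E               ≡⟨ sum-tabulate-single row p (λ x x≢p →
                              sum-tabulate-zero (edgeIndicator E x) (λ y → 0-off-pq x y (x≢p ∘ proj₁))) ⟩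
    row p                ≡⟨ sum-tabulate-single (edgeIndicator E p) q (λ y y≢q → 0-off-pq p y (y≢q ∘ proj₂)) ⟩
    edgeIndicator E p q  ≡⟨ cong₂ (λ a b → if a ∧ b then 1 else 0)
                                  (dec-true (toℕ p <ᵇ-dec toℕ q) p<q) (singleEdge-mem G pq) ⟩
    1                    ∎
    where
    open ≡-Reasoning
    E : EdgeSubset G
    E = singleEdge G pq
    row : Fin n → ℕ
    row x = sum (tabulate (edgeIndicator E x))
    0-off-pq : ∀ x y → ¬ (x ≡ p × y ≡ q) → edgeIndicator E x y ≡ 0
    0-off-pq = singleEdge-indicator G pq p<q

  Adj⇒singleEdge : (G : Graph n) {x y : Fin n} → Adj G x y →
                   Σ (EdgeSubset G) λ E → card E ≡ 1 × mem E x y ≡ true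
  Adj⇒singleEdge G {x} {y} xy with ℕ.<-cmp (toℕ x) (toℕ y)
  ... | tri< x<y _ _ = singleEdge G xy , singleEdge-card G xy x<y , singleEdge-mem G xy
  ... | tri> _ _ y<x = singleEdge G yx , singleEdge-card G yx y<x ,
                       trans (memSym (singleEdge G yx) x y) (singleEdge-mem G yx)
    where
    yx : Adj G y x
    yx = Adj-sym G xy
  ... | tri≈ _ x≡y _ = contradiction (toℕ-injective x≡y) (Adj⇒≢ G xy)

module _ {m : ℕ} where

  ─v-mono : {H G : Graph (suc m)} (v : Fin (suc m)) → H ⊆ᴱ G → (H ─v v) ⊆ᴱ (G ─v v)
  ─v-mono v H⊆G i j = H⊆G (punchIn v i) (punchIn v j)

  IsRDF-─v : (G : Graph (suc m)) {v : Fin (suc m)} {f : Fin (suc m) → ℕ} →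
             Isolated G v → IsRDF G f → IsRDF (G ─v v) (f ∘ punchIn v)
  IsRDF-─v G {v} {f} isolated (f≤2 , dominated) = f≤2 ∘ punchIn v , dominated′
    where
    dominated′ : ∀ i → f (punchIn v i) ≡ 0 → ∃[ j ] (Adj (G ─v v) i j × f (punchIn v j) ≡ 2)
    dominated′ i fi≡0 with w , iw , fw≡2 ← dominated (punchIn v i) fi≡0 | v Fin.≟ w
    ... | yes refl = contradiction (Adj-sym G iw) (isolated (punchIn v i))
    ... | no v≢w   = punchOut v≢w ,
      subst (λ x → Adj G (punchIn v i) x × f x ≡ 2) (sym (punchIn-punchOut v≢w)) (iw , fw≡2)

  leafEdge-increasesγR : (G : Graph (suc m)) → InRUVR G → {v u : Fin (suc m)} → Leaf G v u →
                         (E : EdgeSubset G) → mem E v u ≡ true → IncreasesγR G E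
  leafEdge-increasesγR G ruvr {v} leaf E vu∈E k k′ γG ((f , rdf , wf≡k′) , _)
    with k″ , γG-v ← γR-exists (G ─v v) = begin-strict
      k                             ≡⟨ ruvr v k k″ γG γG-v ⟩
      k″                            ≤⟨ proj₂ γG-v (f ∘ punchIn v) rdf-─v ⟩
      weight (f ∘ punchIn v)        <⟨ ℕ.m<n+m _ (isolated⇒RDF-positive (G ─E E) isolated rdf) ⟩
      f v + weight (f ∘ punchIn v)  ≡⟨ sum-tabulate-punchIn f v ⟨
      weight f                      ≡⟨ wf≡k′ ⟩
      k′                            ∎
    where
    open ℕ.≤-Reasoning
    isolated : Isolated (G ─E E) v
    isolated = Leaf-─E-isolated G E leaf vu∈E
    rdf-─v : IsRDF (G ─v v) (f ∘ punchIn v)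
    rdf-─v = IsRDF-⊆ᴱ {H = (G ─E E) ─v v} {G = G ─v v}
               (─v-mono {H = G ─E E} {G = G} v (─E-⊆ᴱ G E)) (IsRDF-─v (G ─E E) isolated rdf)

module _ {A : Set} where

  AllPairs-++⁻ˡ : {R : A → A → Set} (xs : List A) {ys : List A} → AllPairs R (xs ++ ys) → AllPairs R xs
  AllPairs-++⁻ˡ []       _          = []
  AllPairs-++⁻ˡ (x ∷ xs) (px ∷ pxs) = Allₚ.++⁻ˡ xs px ∷ AllPairs-++⁻ˡ xs pxs

  Unique∧⊆⇒length≤ : {xs ys : List A} → Unique xs → xs ⊆ ys → length xs ≤ length ys
  Unique∧⊆⇒length≤ {[]}     _ _ = z≤n
  Unique∧⊆⇒length≤ {x ∷ xs} {ys} (x∉xs ∷ unique) xs⊆ys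
    with pre , post , refl ← ∈-∃++ (xs⊆ys (here refl)) = begin
      suc (length xs)            ≤⟨ s≤s (Unique∧⊆⇒length≤ unique xs⊆pre++post) ⟩
      suc (length (pre ++ post)) ≡⟨ length-++-sucʳ pre x post ⟨
      length ys                  ∎
    where
    open ℕ.≤-Reasoning
    xs⊆pre++post : xs ⊆ pre ++ post
    xs⊆pre++post {y} y∈xs with ∈-++⁻ pre (xs⊆ys (there y∈xs))
    ... | inj₁ y∈pre          = ∈-++⁺ˡ y∈pre
    ... | inj₂ (here refl)    = contradiction refl (All.lookup x∉xs y∈xs)
    ... | inj₂ (there y∈post) = ∈-++⁺ʳ pre y∈post

Unique⇒length≤ : ∀ {n} (xs : List (Fin n)) → Unique xs → length xs ≤ n
Unique⇒length≤ {n} xs unique =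
  ≤-trans (Unique∧⊆⇒length≤ unique (λ {y} _ → ∈-allFin y))
          (≤-reflexive (length-tabulate {n = n} (λ i → i)))

module _ {n : ℕ} where

  Chain-++⁻ˡ : (G : Graph n) (xs : List (Fin n)) {ys : List (Fin n)} → Chain G (xs ++ ys) → Chain G xs
  Chain-++⁻ˡ G []           _        = _
  Chain-++⁻ˡ G (x ∷ [])     _        = _
  Chain-++⁻ˡ G (x ∷ y ∷ xs) (xy , c) = xy , Chain-++⁻ˡ G (y ∷ xs) c

  -- Paths are stored backwards: x is the current end and y its predecessor.
  module _ (G : Graph n) (acyclic : ¬ HasCycle G) where

    path-chordless : ∀ {x y z r} → Unique (x ∷ y ∷ r) → Chain G (x ∷ y ∷ r) → z ∈ r → ¬ Adj G x z
    path-chordless {x} {y} {z} unique chain z∈r xz with pre , post , refl ← ∈-∃++ z∈r =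
      acyclic (x , z , y ∷ pre , s≤s z≤n ,
               AllPairs-++⁻ˡ cycle (subst Unique split unique) ,
               Chain-++⁻ˡ G cycle (subst (Chain G) split chain) ,
               Adj-sym G xz)
      where
      cycle : List (Fin n)
      cycle = x ∷ y ∷ pre ++ [ z ]
      split : x ∷ y ∷ pre ++ [ z ] ++ post ≡ cycle ++ post
      split = cong (λ l → x ∷ y ∷ l) (sym (++-assoc pre [ z ] post))

    open DecMembership (Fin._≟_ {n}) using (_∈?_; _∉?_)

    -- A stuck end of the path is a leaf: a second neighbour on the path closes a cycle.
    leaf-search : ∀ fuel x y r → n < length (x ∷ y ∷ r) + fuel →
                  Unique (x ∷ y ∷ r) → Chain G (x ∷ y ∷ r) → ∃₂ (Leaf G)
    leaf-search zero x y r too-long unique _ =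
      contradiction (Unique⇒length≤ _ unique) (ℕ.<⇒≱ (subst (n <_) (ℕ.+-identityʳ _) too-long))
    leaf-search (suc fuel) x y r too-long unique chain@(xy , _)
      with any? (λ z → (adj G x z Bool.≟ true) ×-dec (z ∉? (x ∷ y ∷ r)))
    ... | yes (z , xz , z∉path) =
      leaf-search fuel z x (y ∷ r) (subst (n <_) (ℕ.+-suc _ fuel) too-long)
                  (¬Any⇒All¬ _ z∉path ∷ unique) (Adj-sym G xz , chain)
    ... | no stuck = x , y , xy , onlyNeighbour
      where
      onlyNeighbour : ∀ z → Adj G x z → z ≡ y
      onlyNeighbour z xz with z ∈? (x ∷ y ∷ r)
      ... | no  z∉path              = contradiction (z , xz , z∉path) stuck
      ... | yes (here refl)         = contradiction xz (Adj-irrefl G)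
      ... | yes (there (here z≡y))  = z≡y
      ... | yes (there (there z∈r)) = contradiction xz (path-chordless unique chain z∈r)

    acyclic⇒leaf : ∀ {x y} → Adj G x y → ∃₂ (Leaf G)
    acyclic⇒leaf {x} {y} xy =
      leaf-search n x y [] (ℕ.m<n+m n (s≤s z≤n)) ((Adj⇒≢ G xy ∷ []) ∷ [] ∷ []) (xy , _)

  degree-pos⇒neighbour : (G : Graph n) {v : Fin n} → 0 < degree G v → ∃ (Adj G v)
  degree-pos⇒neighbour G {v} deg>0 with any? (λ u → adj G v u Bool.≟ true)
  ... | yes neighbour = neighbour
  ... | no  isolated  = contradiction
    (sum-tabulate-zero _ (λ u → cong (if_then 1 else 0) (¬-not (isolated ∘ (u ,_)))))
    (ℕ.>⇒≢ deg>0)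

RUVR-leaf⇒bondage1 : ∀ {m} (G : Graph (suc m)) → InRUVR G → ∀ {v u} → Leaf G v u → RomanBondage G 1
RUVR-leaf⇒bondage1 G ruvr leaf@(vu , _)
  with E , |E|≡1 , vu∈E ← Adj⇒singleEdge G vu =
  (E , |E|≡1 , leafEdge-increasesγR G ruvr leaf E vu∈E) , increasesγR⇒nonempty G

mainTheorem6 : ∀ {m} (T : Graph (suc m)) → IsTree T → InRUVR T → MaxDegreeAtLeast2 T
                 → RomanBondage T 1
mainTheorem6 T (_ , acyclic) ruvr (v , deg≥2)
  with u , vu ← degree-pos⇒neighbour T (ℕ.<-≤-trans (s≤s z≤n) deg≥2)
  with _ , _ , leaf ← acyclic⇒leaf T acyclic vu
  = RUVR-leaf⇒bondage1 T ruvr leaf
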